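{- The subset \[ \Big\{\Big(g(z^3),\ z,\ \tfrac{f_1(z^3)}{z^2},\ \tfrac{f_2(z^3)}{z^2}\Big): g\in\mathcal{F}_0,\ f_1,f_2\in\mathcal{F}_1\Big\} \] is a subgroup of the Triple Riordan ($3$-Riordan) group.
   Context: Work with formal power series in $z$ over $\mathbb{C}$. Let $\mathcal{F}_0$ be the set of formal power series with nonzero constant term, and $\mathcal{F}_1$ the set of formal power series with zero constant term and nonzero coefficient of $z$. A $3$-Riordan array $(g,f_1,f_2,f_3)$ consists of $g(z)=\tilde g(z^3)$ with $\tilde g\in\mathcal{F}_0$ and $f_i(z)=\hat f_i(z^3)/z^{2}$ with $\hat f_i\in\mathcal{F}_1$; it is the infinite lower-triangular matrix whose column $0$ has generating function $g$ and whose column $n\ge1$ has generating function $g\prod_{m=1}^{n} f_{((m-1)\bmod 3)+1}$ (multiplier functions applied cyclically). The Triple Riordan group is the set of these arrays under matrix multiplication, given by $(g,f_1,f_2,f_3)*(G,F_1,F_2,F_3)=\big(g\,G(h),\ \tfrac{f_1}{h}F_1(h),\ \tfrac{f_2}{h}F_2(h),\ \tfrac{f_3}{h}F_3(h)\big)$ where $h\in\mathcal{F}_1$ satisfies $h^3=f_1f_2f_3$ (the result is independent of the choice of cube root). -}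

module Defs where

open import Level using (Level; _⊔_) renaming (suc to lsuc)
open import Data.Nat as ℕ using (ℕ; zero; suc; _∸_; _%_)
open import Data.List using (List; []; _∷_; length)
open import Data.Product using (Σ; _×_; _,_; ∃)
open import Relation.Nullary using (¬_)
open import Relation.Binary.PropositionalEquality using (_≡_)
open import Algebra.Bundles using (CommutativeRing)

record Field (c ℓ : Level) : Set (lsuc (c ⊔ ℓ)) where
  field
    commRing : CommutativeRing c ℓ
  open CommutativeRing commRing public
  field
    0≉1      : ¬ (0# ≈ 1#)
    inverse  : ∀ x → ¬ (x ≈ 0#) → Σ Carrier λ y → x * y ≈ 1#

module FieldProps {c ℓ} (K : Field c ℓ) where
  open Field K using (Carrier; _≈_; _+_; _*_; 0#; 1#)

  natCast : ℕ → Carrier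
  natCast zero    = 0#
  natCast (suc n) = 1# + natCast n

  CharZero : Set ℓ
  CharZero = ∀ n → ¬ (natCast (suc n) ≈ 0#)

  evalPoly : List Carrier → Carrier → Carrier
  evalPoly []       x = 0#
  evalPoly (a ∷ as) x = a + x * evalPoly as x

  -- algebraically closed: every polynomial a₀ + … + a_{d} x^{d+1}
  -- (degree d+1 ≥ 1, leading coefficient nonzero) has a root.
  AlgClosed : Set (c ⊔ ℓ)
  AlgClosed = ∀ (as : List Carrier) (a₀ lead : Carrier) →
              ¬ (lead ≈ 0#) →
              ∃ λ x → evalPoly (a₀ ∷ (as Data.List.++ (lead ∷ []))) x ≈ 0#

module PowerSeries {c ℓ} (K : Field c ℓ) where
  open Field K using (Carrier; _≈_; _+_; _*_; 0#; 1#)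

  Series : Set c
  Series = ℕ → Carrier

  _≋_ : Series → Series → Set ℓ
  a ≋ b = ∀ n → a n ≈ b n

  sumTo : ℕ → (ℕ → Carrier) → Carrier
  sumTo zero    f = f zero
  sumTo (suc n) f = sumTo n f + f (suc n)

  _⊛_ : Series → Series → Series
  (a ⊛ b) n = sumTo n (λ i → a i * b (n ∸ i))

  one : Series
  one zero    = 1#
  one (suc _) = 0#

  zS : Series
  zS 1 = 1#
  zS _ = 0#

  pow : Series → ℕ → Series
  pow h zero    = one
  pow h (suc k) = h ⊛ pow h k

  -- composition G(h) (used only for h with zero constant term):
  -- [z^n] G(h) = Σ_{k=0}^{n} G_k [z^n] h^k
  _∘ₛ_ : Series → Series → Series
  (G ∘ₛ h) n = sumTo n (λ k → G k * pow h k n)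

  InF₁ : Series → Set ℓ
  InF₁ h = (h 0 ≈ 0#) × ¬ (h 1 ≈ 0#)

  -- g(z) = g̃(z³) with g̃ ∈ 𝓕₀ : only exponents ≡ 0 mod 3, g₀ ≠ 0
  IsG : Series → Set ℓ
  IsG g = ¬ (g 0 ≈ 0#) × (∀ n → ¬ (n % 3 ≡ 0) → g n ≈ 0#)

  -- f(z) = f̂(z³)/z² with f̂ ∈ 𝓕₁ : only exponents ≡ 1 mod 3
  -- (so constant term 0) and f₁ ≠ 0
  IsMult : Series → Set ℓ
  IsMult f = ¬ (f 1 ≈ 0#) × (∀ n → ¬ (n % 3 ≡ 1) → f n ≈ 0#)

  record Quad : Set c where
    constructor quad
    field
      g f₁ f₂ f₃ : Series

  IsTriple : Quad → Set ℓ
  IsTriple (quad g f₁ f₂ f₃) = IsG g × IsMult f₁ × IsMult f₂ × IsMult f₃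

  -- C = A * B in the Triple Riordan group:
  -- for some h ∈ 𝓕₁ with h³ = f₁f₂f₃,
  --   C = (g·G(h), (f₁/h)·F₁(h), (f₂/h)·F₂(h), (f₃/h)·F₃(h)),
  -- where the division by h (a non-zero-divisor) is expressed as
  -- h · Cᵢ = fᵢ · Fᵢ(h).
  IsProduct : Quad → Quad → Quad → Set (c ⊔ ℓ)
  IsProduct (quad g f₁ f₂ f₃) (quad G F₁ F₂ F₃) (quad g' f₁' f₂' f₃') =
    Σ Series λ h →
      InF₁ h ×
      ((h ⊛ (h ⊛ h)) ≋ (f₁ ⊛ (f₂ ⊛ f₃))) ×
      (g' ≋ (g ⊛ (G ∘ₛ h))) ×
      ((h ⊛ f₁') ≋ (f₁ ⊛ (F₁ ∘ₛ h))) ×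
      ((h ⊛ f₂') ≋ (f₂ ⊛ (F₂ ∘ₛ h))) ×
      ((h ⊛ f₃') ≋ (f₃ ⊛ (F₃ ∘ₛ h)))

  identity : Quad
  identity = quad one zS zS zS

  InS : Quad → Set ℓ
  InS (quad g f₁ f₂ f₃) = IsG g × (f₁ ≋ zS) × IsMult f₂ × IsMult f₃

-- Everything is bookkeeping of exponents modulo 3: if a is supported on
-- exponents ≡ r and b on exponents ≡ s, then a·b is supported on exponents
-- ≡ r + s, composing with a series supported on exponents ≡ 1 preserves
-- residues, and dividing by such a series lowers them by one.  The one genuine
-- step is that a cube root h ∈ 𝓕₁ of f₁f₂f₃ (a series in z³) is supported on
-- exponents ≡ 1: if n ≢ 1 were the first exponent with hₙ ≠ 0, the coefficient
-- of z^(n+2) in h³ would be 3h₁²hₙ ≠ 0 although n + 2 ≢ 0.  The first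
-- multiplier stays z because h·f₁' = z·F₁(h) = z·h, and for an inverse
-- F₁(h) = h forces F₁ = z.
module Submission where

open import Defs
open import Data.Product using (_×_; _,_; proj₂)
open import Data.Nat as ℕ
  using (ℕ; zero; suc; _∸_; _%_; _≤_; _<_; z≤n; s≤s; s≤s⁻¹; NonZero)
open import Data.Nat.Properties
  using ( _≟_; _≤?_; ≤-refl; <⇒≢; n<1+n; n≤1+n; m≤n⇒m≤1+n; ≤∧≢⇒<; ≰⇒>; <-≤-trans
        ; m∸n≤m; ∸-monoʳ-<; m<n⇒0<n∸m; m+n∸n≡m; m+[n∸m]≡n; n∸n≡0; m≤n+m
        ; ∸-cancelˡ-≡)
open import Data.Nat.DivMod using (%-distribˡ-+; [m+kn]%n≡m%n)
open import Data.Nat.Induction using (<-rec)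
open import Data.Nat.Tactic.RingSolver using (solve-∀)
open import Function using (_∘_)
open import Relation.Nullary using (¬_; yes; no; contradiction)
open import Relation.Binary.PropositionalEquality as ≡
  using (_≡_; _≢_; ≢-sym; cong; cong₂)

%-+-cancelˡ : ∀ {d} .{{_ : NonZero d}} a {m n} →
              (a ℕ.+ m) % d ≡ (a ℕ.+ n) % d → m % d ≡ n % d
%-+-cancelˡ {d@(suc k)} a {m} {n} eq = begin
  m % d                                    ≡⟨ [m+kn]%n≡m%n m a d ⟨
  (m ℕ.+ a ℕ.* d) % d                      ≡⟨ cong (_% d) (shift m a k) ⟩
  (a ℕ.* k ℕ.+ (a ℕ.+ m)) % d              ≡⟨ %-distribˡ-+ (a ℕ.* k) (a ℕ.+ m) d ⟩
  ((a ℕ.* k) % d ℕ.+ (a ℕ.+ m) % d) % d    ≡⟨ cong (λ x → ((a ℕ.* k) % d ℕ.+ x) % d) eq ⟩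
  ((a ℕ.* k) % d ℕ.+ (a ℕ.+ n) % d) % d    ≡⟨ %-distribˡ-+ (a ℕ.* k) (a ℕ.+ n) d ⟨
  (a ℕ.* k ℕ.+ (a ℕ.+ n)) % d              ≡⟨ cong (_% d) (shift n a k) ⟨
  (n ℕ.+ a ℕ.* d) % d                      ≡⟨ [m+kn]%n≡m%n n a d ⟩
  n % d                                    ∎
  where
  open ≡.≡-Reasoning
  shift : ∀ x a k → x ℕ.+ a ℕ.* suc k ≡ a ℕ.* k ℕ.+ (a ℕ.+ x)
  shift = solve-∀

%-split : ∀ {d} .{{_ : NonZero d}} {i n r s} → i ≤ n →
          i % d ≡ r % d → (n ∸ i) % d ≡ s % d → n % d ≡ (r ℕ.+ s) % d
%-split {d} {i} {n} {r} {s} i≤n i≡r n∸i≡s = begin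
  n % d                            ≡⟨ cong (_% d) (m+[n∸m]≡n i≤n) ⟨
  (i ℕ.+ (n ∸ i)) % d              ≡⟨ %-distribˡ-+ i (n ∸ i) d ⟩
  (i % d ℕ.+ (n ∸ i) % d) % d      ≡⟨ cong₂ (λ x y → (x ℕ.+ y) % d) i≡r n∸i≡s ⟩
  (r % d ℕ.+ s % d) % d            ≡⟨ %-distribˡ-+ r s d ⟨
  (r ℕ.+ s) % d                    ∎
  where open ≡.≡-Reasoning

module _ {c ℓ} (K : Field c ℓ) where
  open Field K
  open FieldProps K using (natCast)
  open PowerSeries K
  open import Algebra.Properties.Group +-group using ()
    renaming (∙-cancelˡ to +-cancelˡ; ∙-cancelʳ to +-cancelʳ)
  open import Relation.Binary.Reasoning.Setoid setoid

  *-≈0ˡ : ∀ {x y} → x ≈ 0# → x * y ≈ 0#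
  *-≈0ˡ {y = y} x≈0 = trans (*-congʳ x≈0) (zeroˡ y)

  *-≈0ʳ : ∀ {x y} → y ≈ 0# → x * y ≈ 0#
  *-≈0ʳ {x} y≈0 = trans (*-congˡ y≈0) (zeroʳ x)

  *-cancelˡ-≉0 : ∀ {x y z} → ¬ x ≈ 0# → x * y ≈ x * z → y ≈ z
  *-cancelˡ-≉0 {x} {y} {z} x≉0 xy≈xz with inverse x x≉0
  ... | x⁻¹ , xx⁻¹≈1 = begin
    y                 ≈⟨ sym (*-identityˡ y) ⟩
    1# * y            ≈⟨ *-congʳ (trans (sym xx⁻¹≈1) (*-comm x x⁻¹)) ⟩
    (x⁻¹ * x) * y     ≈⟨ *-assoc x⁻¹ x y ⟩
    x⁻¹ * (x * y)     ≈⟨ *-congˡ xy≈xz ⟩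
    x⁻¹ * (x * z)     ≈⟨ sym (*-assoc x⁻¹ x z) ⟩
    (x⁻¹ * x) * z     ≈⟨ *-congʳ (trans (*-comm x⁻¹ x) xx⁻¹≈1) ⟩
    1# * z            ≈⟨ *-identityˡ z ⟩
    z                 ∎

  *-cancelʳ-≉0 : ∀ {x y z} → ¬ x ≈ 0# → y * x ≈ z * x → y ≈ z
  *-cancelʳ-≉0 {x} {y} {z} x≉0 yx≈zx =
    *-cancelˡ-≉0 x≉0 (trans (*-comm x y) (trans yx≈zx (*-comm z x)))

  x*y≈0⇒y≈0 : ∀ {x y} → ¬ x ≈ 0# → x * y ≈ 0# → y ≈ 0#
  x*y≈0⇒y≈0 x≉0 xy≈0 = *-cancelˡ-≉0 x≉0 (trans xy≈0 (sym (zeroʳ _)))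

  *-≉0 : ∀ {x y} → ¬ x ≈ 0# → ¬ y ≈ 0# → ¬ x * y ≈ 0#
  *-≉0 x≉0 y≉0 = y≉0 ∘ x*y≈0⇒y≈0 x≉0

  1≉0 : ¬ 1# ≈ 0#
  1≉0 = 0≉1 ∘ sym

  three-cross-terms : ∀ x y →
    x * (x * y + y * x) + y * (x * x) ≈ natCast 3 * (x * (x * y))
  three-cross-terms x y = begin
    x * (x * y + y * x) + y * (x * x)      ≈⟨ +-cong (distribˡ x (x * y) (y * x))
                                                      (trans (*-comm y (x * x)) (*-assoc x x y)) ⟩
    (x * (x * y) + x * (y * x)) + t        ≈⟨ +-congʳ (+-congˡ (*-congˡ (*-comm y x))) ⟩
    (t + t) + t                            ≈⟨ +-assoc t t t ⟩
    t + (t + t)                            ≈⟨ +-congˡ (+-congˡ (sym (+-identityʳ t))) ⟩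
    t + (t + (t + 0#))                     ≈⟨ +-cong (*-identityˡ t)
                                                (+-cong (*-identityˡ t) (+-cong (*-identityˡ t) (zeroˡ t))) ⟨
    1# * t + (1# * t + (1# * t + 0# * t))  ≈⟨ sym (+-congˡ (+-congˡ (distribʳ t 1# 0#))) ⟩
    1# * t + (1# * t + (1# + 0#) * t)      ≈⟨ sym (+-congˡ (distribʳ t 1# (1# + 0#))) ⟩
    1# * t + (1# + (1# + 0#)) * t          ≈⟨ sym (distribʳ t 1# (1# + (1# + 0#))) ⟩
    natCast 3 * t                          ∎
    where t = x * (x * y)

  sumTo-cong : ∀ n {f g : ℕ → Carrier} →
               (∀ i → i ≤ n → f i ≈ g i) → sumTo n f ≈ sumTo n g
  sumTo-cong zero    f≈g = f≈g 0 z≤n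
  sumTo-cong (suc n) f≈g =
    +-cong (sumTo-cong n (λ i → f≈g i ∘ m≤n⇒m≤1+n)) (f≈g (suc n) ≤-refl)

  sumTo-≈0 : ∀ n {f : ℕ → Carrier} → (∀ i → i ≤ n → f i ≈ 0#) → sumTo n f ≈ 0#
  sumTo-≈0 zero    f≈0 = f≈0 0 z≤n
  sumTo-≈0 (suc n) f≈0 =
    trans (+-cong (sumTo-≈0 n (λ i → f≈0 i ∘ m≤n⇒m≤1+n)) (f≈0 (suc n) ≤-refl))
          (+-identityˡ 0#)

  sumTo-single : ∀ {n j} {f : ℕ → Carrier} → j ≤ n →
                 (∀ i → i ≤ n → i ≢ j → f i ≈ 0#) → sumTo n f ≈ f j
  sumTo-single {zero} z≤n _ = refl
  sumTo-single {suc n} {j} j≤ others with j ≟ suc n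
  ... | yes ≡.refl =
    trans (+-congʳ (sumTo-≈0 n (λ i i≤n → others i (m≤n⇒m≤1+n i≤n) (<⇒≢ (s≤s i≤n)))))
          (+-identityˡ _)
  ... | no j≢ =
    trans (+-cong (sumTo-single (s≤s⁻¹ (≤∧≢⇒< j≤ j≢)) (λ i → others i ∘ m≤n⇒m≤1+n))
                  (others (suc n) ≤-refl (≢-sym j≢)))
          (+-identityʳ _)

  sumTo-pair : ∀ {n j k} {f : ℕ → Carrier} → j < k → k ≤ n →
               (∀ i → i ≤ n → i ≢ j → i ≢ k → f i ≈ 0#) → sumTo n f ≈ f j + f k
  sumTo-pair {zero} () z≤n _
  sumTo-pair {suc n} {j} {k} j<k k≤ others with k ≟ suc n
  ... | yes ≡.refl =
    +-congʳ (sumTo-single (s≤s⁻¹ j<k)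
               (λ i i≤n i≢j → others i (m≤n⇒m≤1+n i≤n) i≢j (<⇒≢ (s≤s i≤n))))
  ... | no k≢ =
    trans (+-cong (sumTo-pair j<k k≤n (λ i → others i ∘ m≤n⇒m≤1+n))
                  (others (suc n) ≤-refl (≢-sym (<⇒≢ (m≤n⇒m≤1+n j<n))) (≢-sym k≢)))
          (+-identityʳ _)
    where
    k≤n = s≤s⁻¹ (≤∧≢⇒< k≤ k≢)
    j<n = <-≤-trans j<k k≤n

  sumTo-cancel : ∀ {n j} {f g : ℕ → Carrier} → j ≤ n →
                 (∀ i → i ≤ n → i ≢ j → f i ≈ g i) →
                 sumTo n f ≈ sumTo n g → f j ≈ g j
  sumTo-cancel {zero} z≤n _ Σf≈Σg = Σf≈Σg
  sumTo-cancel {suc n} {j} j≤ others Σf≈Σg with j ≟ suc n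
  ... | yes ≡.refl = +-cancelˡ _ _ _
    (trans (+-congʳ (sumTo-cong n λ i i≤n → sym (others i (m≤n⇒m≤1+n i≤n) (<⇒≢ (s≤s i≤n)))))
           Σf≈Σg)
  ... | no j≢ = sumTo-cancel (s≤s⁻¹ (≤∧≢⇒< j≤ j≢)) (λ i → others i ∘ m≤n⇒m≤1+n)
    (+-cancelʳ _ _ _ (trans Σf≈Σg (+-congˡ (sym (others (suc n) ≤-refl (≢-sym j≢))))))

  ≋-sym : ∀ {a b} → a ≋ b → b ≋ a
  ≋-sym a≋b n = sym (a≋b n)

  ≋-trans : ∀ {a b e} → a ≋ b → b ≋ e → a ≋ e
  ≋-trans a≋b b≋e n = trans (a≋b n) (b≋e n)

  ⊛-congˡ : ∀ {a a' b} → a ≋ a' → (a ⊛ b) ≋ (a' ⊛ b)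
  ⊛-congˡ a≋a' n = sumTo-cong n (λ i _ → *-congʳ (a≋a' i))

  ⊛-congʳ : ∀ {a b b'} → b ≋ b' → (a ⊛ b) ≋ (a ⊛ b')
  ⊛-congʳ b≋b' n = sumTo-cong n (λ i _ → *-congˡ (b≋b' _))

  ∘ₛ-congˡ : ∀ {G G' h} → G ≋ G' → (G ∘ₛ h) ≋ (G' ∘ₛ h)
  ∘ₛ-congˡ G≋G' n = sumTo-cong n (λ k _ → *-congʳ (G≋G' k))

  ⊛-coeff-2 : ∀ {a b} → a 0 ≈ 0# → b 0 ≈ 0# → (a ⊛ b) 2 ≈ a 1 * b 1
  ⊛-coeff-2 {a} {b} a0 b0 = begin
    (a 0 * b 2 + a 1 * b 1) + a 2 * b 0  ≈⟨ +-cong (+-congʳ (*-≈0ˡ a0)) (*-≈0ʳ b0) ⟩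
    (0# + a 1 * b 1) + 0#                ≈⟨ trans (+-identityʳ _) (+-identityˡ _) ⟩
    a 1 * b 1                            ∎

  ∘ₛ-coeff-1 : ∀ G h → (G ∘ₛ h) 1 ≈ G 1 * h 1
  ∘ₛ-coeff-1 G h = begin
    G 0 * 0# + G 1 * (h 0 * 0# + h 1 * 1#)
      ≈⟨ +-cong (zeroʳ _) (*-congˡ (+-cong (zeroʳ _) (*-identityʳ _))) ⟩
    0# + G 1 * (0# + h 1)
      ≈⟨ trans (+-identityˡ _) (*-congˡ (+-identityˡ _)) ⟩
    G 1 * h 1
      ∎

  ⊛-one : ∀ {a} → (a ⊛ one) ≋ a
  ⊛-one {a} n = trans (sumTo-single ≤-refl below)
                      (trans (*-congˡ (reflexive (cong one (n∸n≡0 n)))) (*-identityʳ (a n)))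
    where
    one-pos : ∀ {m} → 0 < m → one m ≈ 0#
    one-pos {suc _} _ = refl
    below : ∀ i → i ≤ n → i ≢ n → a i * one (n ∸ i) ≈ 0#
    below i i≤n i≢n = *-≈0ʳ (one-pos (m<n⇒0<n∸m (≤∧≢⇒< i≤n i≢n)))

  zS-≈0 : ∀ {k} → k ≢ 1 → zS k ≈ 0#
  zS-≈0 {0}           _   = refl
  zS-≈0 {1}           k≢1 = contradiction ≡.refl k≢1
  zS-≈0 {suc (suc _)} _   = refl

  zS-⊛-suc : ∀ a n → (zS ⊛ a) (suc n) ≈ a n
  zS-⊛-suc a n =
    trans (sumTo-single {suc n} (s≤s z≤n) (λ i _ → *-≈0ˡ ∘ zS-≈0 {i})) (*-identityˡ (a n))

  ⊛-zS-suc : ∀ a n → (a ⊛ zS) (suc n) ≈ a n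
  ⊛-zS-suc a n = trans (sumTo-single (n≤1+n n) others)
                       (trans (*-congˡ (reflexive (cong zS (m+n∸n≡m 1 n)))) (*-identityʳ (a n)))
    where
    others : ∀ i → i ≤ suc n → i ≢ n → a i * zS (suc n ∸ i) ≈ 0#
    others i i≤ i≢n = *-≈0ʳ (zS-≈0 λ e →
      i≢n (∸-cancelˡ-≡ i≤ (n≤1+n n) (≡.trans e (≡.sym (m+n∸n≡m 1 n)))))

  ⊛-zS-comm : ∀ a → (a ⊛ zS) ≋ (zS ⊛ a)
  ⊛-zS-comm a zero    = *-comm (a 0) (zS 0)
  ⊛-zS-comm a (suc n) = trans (⊛-zS-suc a n) (sym (zS-⊛-suc a n))

  zS-⊛-injective : ∀ {a b} → (zS ⊛ a) ≋ (zS ⊛ b) → a ≋ b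
  zS-⊛-injective {a} {b} za≋zb n =
    trans (sym (zS-⊛-suc a n)) (trans (za≋zb (suc n)) (zS-⊛-suc b n))

  zS-∘ₛ : ∀ {h} → h 0 ≈ 0# → (zS ∘ₛ h) ≋ h
  zS-∘ₛ         h0 zero    = trans (zeroˡ _) (sym h0)
  zS-∘ₛ {h} h0 (suc n) =
    trans (sumTo-single {suc n} (s≤s z≤n) (λ k _ → *-≈0ˡ ∘ zS-≈0 {k}))
          (trans (*-identityˡ _) (⊛-one {h} (suc n)))

  pow-below : ∀ {h} → h 0 ≈ 0# → ∀ k {m} → m < k → pow h k m ≈ 0#
  pow-below {h} h0 (suc k) {m} m<1+k = sumTo-≈0 m term
    where
    term : ∀ i → i ≤ m → h i * pow h k (m ∸ i) ≈ 0#
    term zero    _    = *-≈0ˡ h0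
    term (suc i) i<m =
      *-≈0ʳ (pow-below h0 k (<-≤-trans (∸-monoʳ-< (s≤s z≤n) i<m) (s≤s⁻¹ m<1+k)))

  module _ {h : Series} (h0 : h 0 ≈ 0#) (h1 : ¬ h 1 ≈ 0#) where

    pow-diagonal-≉0 : ∀ k → ¬ pow h k k ≈ 0#
    pow-diagonal-≉0 zero    = 1≉0
    pow-diagonal-≉0 (suc k) =
      *-≉0 h1 (pow-diagonal-≉0 k) ∘ trans (sym (sumTo-single (s≤s z≤n) others))
      where
      others : ∀ i → i ≤ suc k → i ≢ 1 → h i * pow h k (suc k ∸ i) ≈ 0#
      others zero          _  _   = *-≈0ˡ h0
      others 1             _  i≢1 = contradiction ≡.refl i≢1
      others (suc (suc i)) i≤ _   = *-≈0ʳ (pow-below h0 k (∸-monoʳ-< (s≤s (s≤s z≤n)) i≤))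

    ⊛-cancelˡ : ∀ {a b} → (h ⊛ a) ≋ (h ⊛ b) → a ≋ b
    ⊛-cancelˡ {a} {b} ha≋hb = <-rec (λ n → a n ≈ b n) step
      where
      step : ∀ n → (∀ {m} → m < n → a m ≈ b m) → a n ≈ b n
      step n ih = *-cancelˡ-≉0 h1 (sumTo-cancel (s≤s z≤n) others (ha≋hb (suc n)))
        where
        others : ∀ i → i ≤ suc n → i ≢ 1 → h i * a (suc n ∸ i) ≈ h i * b (suc n ∸ i)
        others zero          _  _   = trans (*-≈0ˡ h0) (sym (*-≈0ˡ h0))
        others 1             _  i≢1 = contradiction ≡.refl i≢1
        others (suc (suc i)) i≤ _   = *-congˡ (ih (∸-monoʳ-< (s≤s (s≤s z≤n)) i≤))

    ∘ₛ-cancelʳ : ∀ {F G} → (F ∘ₛ h) ≋ (G ∘ₛ h) → F ≋ G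
    ∘ₛ-cancelʳ {F} {G} Fh≋Gh = <-rec (λ n → F n ≈ G n) step
      where
      step : ∀ n → (∀ {m} → m < n → F m ≈ G m) → F n ≈ G n
      step n ih = *-cancelʳ-≉0 (pow-diagonal-≉0 n)
        (sumTo-cancel ≤-refl (λ k k≤n k≢n → *-congʳ (ih (≤∧≢⇒< k≤n k≢n))) (Fh≋Gh n))

  module Residues (d : ℕ) .{{_ : NonZero d}} where

    _≡ₘ_ : ℕ → ℕ → Set
    m ≡ₘ n = m % d ≡ n % d

    Supp : ℕ → Series → Set ℓ
    Supp r a = ∀ n → ¬ n ≡ₘ r → a n ≈ 0#

    SuppBelow : ℕ → ℕ → Series → Set ℓ
    SuppBelow n r a = ∀ {m} → m < n → ¬ m ≡ₘ r → a m ≈ 0#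

    Supp⇒SuppBelow : ∀ {r a n} → Supp r a → SuppBelow n r a
    Supp⇒SuppBelow aₛ {m} _ = aₛ m

    Supp-by-induction : ∀ {r a} → (∀ n → SuppBelow n r a → ¬ n ≡ₘ r → a n ≈ 0#) → Supp r a
    Supp-by-induction {r} {a} = <-rec (λ n → ¬ n ≡ₘ r → a n ≈ 0#)

    Supp-cong : ∀ {r a b} → a ≋ b → Supp r a → Supp r b
    Supp-cong a≋b aₛ n n≢r = trans (sym (a≋b n)) (aₛ n n≢r)

    ⊛-term-≈0 : ∀ {r s a b N M m i} → SuppBelow N r a → SuppBelow M s b →
                ¬ m ≡ₘ (r ℕ.+ s) → i ≤ m → i < N → m ∸ i < M → a i * b (m ∸ i) ≈ 0#
    ⊛-term-≈0 {r} {s} {m = m} {i} aₛ bₛ m≢r+s i≤m i<N m∸i<M with i % d ≟ r % d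
    ... | no i≢r = *-≈0ˡ (aₛ i<N i≢r)
    ... | yes i≡r with (m ∸ i) % d ≟ s % d
    ...   | no m∸i≢s  = *-≈0ʳ (bₛ m∸i<M m∸i≢s)
    ...   | yes m∸i≡s = contradiction (%-split {r = r} {s} i≤m i≡r m∸i≡s) m≢r+s

    Supp-⊛ : ∀ {r s a b} → Supp r a → Supp s b → Supp (r ℕ.+ s) (a ⊛ b)
    Supp-⊛ aₛ bₛ m m≢r+s = sumTo-≈0 m λ i i≤m →
      ⊛-term-≈0 (Supp⇒SuppBelow aₛ) (Supp⇒SuppBelow bₛ) m≢r+s
                i≤m (s≤s i≤m) (s≤s (m∸n≤m m i))

    SuppBelow-⊛ : ∀ {r s a b n} → a 0 ≈ 0# → b 0 ≈ 0# →
                  SuppBelow n r a → SuppBelow n s b → SuppBelow (suc n) (r ℕ.+ s) (a ⊛ b)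
    SuppBelow-⊛ {a = a} {b} {n} a0 b0 aₛ bₛ {m} m≤n m≢r+s = sumTo-≈0 m term
      where
      term : ∀ i → i ≤ m → a i * b (m ∸ i) ≈ 0#
      term zero    _   = *-≈0ˡ a0
      term (suc i) i<m with suc i ≟ m
      ... | yes ≡.refl = *-≈0ʳ (trans (reflexive (cong b (n∸n≡0 m))) b0)
      ... | no  i≢m  = ⊛-term-≈0 aₛ bₛ m≢r+s i<m
                         (<-≤-trans (≤∧≢⇒< i<m i≢m) (s≤s⁻¹ m≤n))
                         (<-≤-trans (∸-monoʳ-< (s≤s z≤n) i<m) (s≤s⁻¹ m≤n))

    Supp-one : Supp 0 one
    Supp-one zero    0≢0 = contradiction ≡.refl 0≢0
    Supp-one (suc _) _   = refl

    Supp-pow : ∀ {h} → Supp 1 h → ∀ k → Supp k (pow h k)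
    Supp-pow hₛ zero    = Supp-one
    Supp-pow hₛ (suc k) = Supp-⊛ hₛ (Supp-pow hₛ k)

    Supp-∘ₛ : ∀ {r G h} → Supp r G → Supp 1 h → Supp r (G ∘ₛ h)
    Supp-∘ₛ {r} {G} {h} Gₛ hₛ n n≢r = sumTo-≈0 n term
      where
      term : ∀ k → k ≤ n → G k * pow h k n ≈ 0#
      term k _ with k % d ≟ r % d
      ... | no  k≢r = *-≈0ˡ (Gₛ k k≢r)
      ... | yes k≡r = *-≈0ʳ (Supp-pow hₛ k n (n≢r ∘ λ n≡k → ≡.trans n≡k k≡r))

    Supp-÷ : ∀ {h a r} → h 0 ≈ 0# → ¬ h 1 ≈ 0# → Supp 1 h →
             Supp (1 ℕ.+ r) (h ⊛ a) → Supp r a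
    Supp-÷ {h} {a} {r} h0 h1 hₛ haₛ = Supp-by-induction step
      where
      step : ∀ n → SuppBelow n r a → ¬ n ≡ₘ r → a n ≈ 0#
      step n aₛ n≢r = x*y≈0⇒y≈0 h1 (begin
        h 1 * a n        ≈⟨ sym (sumTo-single (s≤s z≤n) others) ⟩
        (h ⊛ a) (suc n)  ≈⟨ haₛ (suc n) suc-n≢1+r ⟩
        0#               ∎)
        where
        suc-n≢1+r : ¬ suc n ≡ₘ (1 ℕ.+ r)
        suc-n≢1+r = n≢r ∘ %-+-cancelˡ 1
        others : ∀ i → i ≤ suc n → i ≢ 1 → h i * a (suc n ∸ i) ≈ 0#
        others zero          _  _   = *-≈0ˡ h0
        others 1             _  i≢1 = contradiction ≡.refl i≢1
        others (suc (suc i)) i≤ _   = ⊛-term-≈0 (Supp⇒SuppBelow hₛ) aₛ suc-n≢1+r i≤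
                                        (n<1+n _) (∸-monoʳ-< (s≤s (s≤s z≤n)) i≤)

    ⊛-two-terms : ∀ {s a b n t} → 1 < n → a 0 ≈ 0# → SuppBelow n 1 a →
                  (∀ {j} → j < t → b j ≈ 0#) → SuppBelow (t ℕ.+ n ∸ 1) s b →
                  ¬ (t ℕ.+ n) ≡ₘ (1 ℕ.+ s) →
                  (a ⊛ b) (t ℕ.+ n) ≈ a 1 * b (t ℕ.+ n ∸ 1) + a n * b t
    ⊛-two-terms {s} {a} {b} {n} {t} 1<n a0 aₛ b-low bₛ t+n≢1+s =
      trans (sumTo-pair 1<n (m≤n+m n t) others) (+-congˡ (*-congˡ (reflexive (cong b (m+n∸n≡m t n)))))
      where
      others : ∀ i → i ≤ t ℕ.+ n → i ≢ 1 → i ≢ n → a i * b (t ℕ.+ n ∸ i) ≈ 0#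
      others zero    _  _   _   = *-≈0ˡ a0
      others 1       _  i≢1 _   = contradiction ≡.refl i≢1
      others i@(suc (suc _)) i≤ _ i≢n with i ≤? n
      ... | yes i≤n =
        ⊛-term-≈0 aₛ bₛ t+n≢1+s i≤ (≤∧≢⇒< i≤n i≢n) (∸-monoʳ-< (s≤s (s≤s z≤n)) i≤)
      ... | no  i≰n =
        *-≈0ʳ (b-low (≡.subst (t ℕ.+ n ∸ i <_) (m+n∸n≡m t n) (∸-monoʳ-< (≰⇒> i≰n) i≤)))

  open Residues 3

  Supp-cube-root : ¬ natCast 3 ≈ 0# → ∀ {h} → h 0 ≈ 0# → ¬ h 1 ≈ 0# →
                   Supp 0 (h ⊛ (h ⊛ h)) → Supp 1 h
  Supp-cube-root 3≉0 {h} h0 h1 h³ₛ = Supp-by-induction {1} step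
    where
    step : ∀ n → SuppBelow n 1 h → ¬ n ≡ₘ 1 → h n ≈ 0#
    step zero          _  _   = h0
    step 1             _  n≢1 = contradiction ≡.refl n≢1
    step n@(suc (suc _)) hₛ n≢1 =
      x*y≈0⇒y≈0 h1 (x*y≈0⇒y≈0 h1 (x*y≈0⇒y≈0 3≉0 (begin
        natCast 3 * (h 1 * (h 1 * h n))                    ≈⟨ sym (three-cross-terms (h 1) (h n)) ⟩
        h 1 * (h 1 * h n + h n * h 1) + h n * (h 1 * h 1)  ≈⟨ sym h³-coeff ⟩
        (h ⊛ (h ⊛ h)) (2 ℕ.+ n)                              ≈⟨ h³ₛ (2 ℕ.+ n) 2+n≢3 ⟩
        0#                                                 ∎)))
      where
      1+n≢2 : ¬ suc n ≡ₘ 2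
      1+n≢2 = n≢1 ∘ %-+-cancelˡ {3} 1 {n} {1}
      2+n≢3 : ¬ (2 ℕ.+ n) ≡ₘ 3
      2+n≢3 = n≢1 ∘ %-+-cancelˡ {3} 2 {n} {1}
      h²ₛ : SuppBelow (suc n) 2 (h ⊛ h)
      h²ₛ = SuppBelow-⊛ {1} {1} h0 h0 hₛ hₛ
      h²-low : ∀ {j} → j < 2 → (h ⊛ h) j ≈ 0#
      h²-low {0} _ = h²ₛ (s≤s z≤n) λ ()
      h²-low {1} _ = h²ₛ (s≤s (s≤s z≤n)) λ ()
      h²-low {suc (suc _)} (s≤s (s≤s ()))
      h²-coeff : (h ⊛ h) (suc n) ≈ h 1 * h n + h n * h 1
      h²-coeff =
        ⊛-two-terms {1} {h} {h} (s≤s (s≤s z≤n)) h0 hₛ (λ { (s≤s z≤n) → h0 }) hₛ 1+n≢2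
      h³-coeff : (h ⊛ (h ⊛ h)) (2 ℕ.+ n) ≈ h 1 * (h 1 * h n + h n * h 1) + h n * (h 1 * h 1)
      h³-coeff = trans (⊛-two-terms {2} {h} {h ⊛ h} (s≤s (s≤s z≤n)) h0 hₛ h²-low h²ₛ 2+n≢3)
                       (+-cong (*-congˡ h²-coeff) (*-congˡ (⊛-coeff-2 {h} {h} h0 h0)))

  IsMult-quotient : ∀ {h f F f'} → h 0 ≈ 0# → ¬ h 1 ≈ 0# → Supp 1 h →
                    (h ⊛ f') ≋ (f ⊛ (F ∘ₛ h)) → IsMult f → IsMult F → IsMult f'
  IsMult-quotient {h} {f} {F} {f'} h0 h1 hₛ hf'≋fFh (f1 , fₛ) (F1 , Fₛ) = f'1≉0 , f'ₛ
    where
    f'ₛ : Supp 1 f'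
    f'ₛ = Supp-÷ {h} {f'} {1} h0 h1 hₛ
            (Supp-cong {2} (≋-sym hf'≋fFh) (Supp-⊛ {1} {1} fₛ (Supp-∘ₛ {1} Fₛ hₛ)))
    f'1≉0 : ¬ f' 1 ≈ 0#
    f'1≉0 f'1≈0 = *-≉0 f1 (*-≉0 F1 h1) (begin
      f 1 * (F 1 * h 1)      ≈⟨ sym (*-congˡ (∘ₛ-coeff-1 F h)) ⟩
      f 1 * (F ∘ₛ h) 1       ≈⟨ ⊛-coeff-2 {f} {F ∘ₛ h} (fₛ 0 λ ()) (trans (*-identityʳ _) (Fₛ 0 λ ())) ⟨
      (f ⊛ (F ∘ₛ h)) 2       ≈⟨ sym (hf'≋fFh 2) ⟩
      (h ⊛ f') 2             ≈⟨ ⊛-coeff-2 {h} {f'} h0 (f'ₛ 0 λ ()) ⟩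
      h 1 * f' 1             ≈⟨ *-≈0ʳ f'1≈0 ⟩
      0#                     ∎)

  zS-IsMult : ∀ {f} → f ≋ zS → IsMult f
  zS-IsMult f≋z = (λ f1≈0 → 1≉0 (trans (sym (f≋z 1)) f1≈0))
                , (λ n n≢1 → trans (f≋z n) (zS-≈0 {n} (n≢1 ∘ cong (_% 3))))

  InS⇒IsTriple : ∀ A → InS A → IsTriple A
  InS⇒IsTriple _ (g , f₁≋z , f₂ , f₃) = g , zS-IsMult f₁≋z , f₂ , f₃

  identity-InS : InS identity
  identity-InS = (1≉0 , Supp-one) , (λ _ → refl) , zS-IsMult (λ _ → refl) , zS-IsMult (λ _ → refl)

  InS-closed-under-product : ¬ natCast 3 ≈ 0# → ∀ A B C → InS A → InS B → IsProduct A B C → InS C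
  InS-closed-under-product 3≉0 (quad g f₁ f₂ f₃) (quad G F₁ F₂ F₃) (quad g' f₁' f₂' f₃')
    ((g0 , gₛ) , f₁≋z , f₂-mult , f₃-mult) ((G0 , Gₛ) , F₁≋z , F₂-mult , F₃-mult)
    (h , (h0 , h1) , h³≋f₁f₂f₃ , g'≋gGh , hf₁'≋ , hf₂'≋ , hf₃'≋) =
    (g'0≉0 , g'ₛ) , f₁'≋z , IsMult-quotient h0 h1 hₛ hf₂'≋ f₂-mult F₂-mult
                          , IsMult-quotient h0 h1 hₛ hf₃'≋ f₃-mult F₃-mult
    where
    f₁f₂f₃ₛ : Supp 3 (f₁ ⊛ (f₂ ⊛ f₃))
    f₁f₂f₃ₛ = Supp-⊛ {1} {2} (proj₂ (zS-IsMult f₁≋z))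
                            (Supp-⊛ {1} {1} (proj₂ f₂-mult) (proj₂ f₃-mult))
    hₛ : Supp 1 h
    hₛ = Supp-cube-root 3≉0 h0 h1 (Supp-cong {0} (≋-sym h³≋f₁f₂f₃) f₁f₂f₃ₛ)
    g'ₛ : Supp 0 g'
    g'ₛ = Supp-cong {0} (≋-sym g'≋gGh) (Supp-⊛ {0} {0} gₛ (Supp-∘ₛ {0} Gₛ hₛ))
    g'0≉0 : ¬ g' 0 ≈ 0#
    g'0≉0 = *-≉0 g0 (*-≉0 G0 1≉0) ∘ trans (sym (g'≋gGh 0))
    hf₁'≋hz : (h ⊛ f₁') ≋ (h ⊛ zS)
    hf₁'≋hz n = begin
      (h ⊛ f₁') n            ≈⟨ hf₁'≋ n ⟩
      (f₁ ⊛ (F₁ ∘ₛ h)) n     ≈⟨ ⊛-congˡ {b = F₁ ∘ₛ h} f₁≋z n ⟩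
      (zS ⊛ (F₁ ∘ₛ h)) n     ≈⟨ ⊛-congʳ {zS} (∘ₛ-congˡ F₁≋z) n ⟩
      (zS ⊛ (zS ∘ₛ h)) n     ≈⟨ ⊛-congʳ {zS} (zS-∘ₛ h0) n ⟩
      (zS ⊛ h) n             ≈⟨ ⊛-zS-comm h n ⟨
      (h ⊛ zS) n             ∎
    f₁'≋z : f₁' ≋ zS
    f₁'≋z = ⊛-cancelˡ h0 h1 hf₁'≋hz

  InS-closed-under-inverse : ∀ A B → InS A → IsTriple B → IsProduct A B identity → InS B
  InS-closed-under-inverse (quad g f₁ f₂ f₃) (quad G F₁ F₂ F₃)
    (_ , f₁≋z , _) (G-ok , _ , F₂-mult , F₃-mult) (h , (h0 , h1) , _ , _ , hz≋f₁F₁h , _) =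
    G-ok , F₁≋z , F₂-mult , F₃-mult
    where
    zh≋zF₁h : (zS ⊛ h) ≋ (zS ⊛ (F₁ ∘ₛ h))
    zh≋zF₁h n = begin
      (zS ⊛ h) n             ≈⟨ ⊛-zS-comm h n ⟨
      (h ⊛ zS) n             ≈⟨ hz≋f₁F₁h n ⟩
      (f₁ ⊛ (F₁ ∘ₛ h)) n     ≈⟨ ⊛-congˡ {b = F₁ ∘ₛ h} f₁≋z n ⟩
      (zS ⊛ (F₁ ∘ₛ h)) n     ∎
    F₁≋z : F₁ ≋ zS
    F₁≋z = ∘ₛ-cancelʳ h0 h1 (≋-trans (≋-sym (zS-⊛-injective zh≋zF₁h)) (≋-sym (zS-∘ₛ h0)))

lemma2p2 : ∀ {c ℓ} (K : Field c ℓ) →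
    FieldProps.CharZero K → FieldProps.AlgClosed K →
    let open PowerSeries K in
      (∀ A → InS A → IsTriple A) ×
      InS identity ×
      (∀ A B C → InS A → InS B → IsProduct A B C → InS C) ×
      (∀ A B → InS A → IsTriple B → IsProduct A B identity → InS B)
lemma2p2 K charZero _ =
  InS⇒IsTriple K , identity-InS K , InS-closed-under-product K (charZero 2) , InS-closed-under-inverse K
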